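{- Let $k,d\in\mathbb{N}$, let $t\in\{0,\dots,k\}$, and let $D$ be a $(k,d)$-broom digraph with root set $R$. Then there exists a $t$-typed $(k,\lceil d/2^{t(t-1)/2}\rceil)$-broom digraph $D'\subseteq D$ with root set $R$.
   Context: An out-arborescence is an oriented tree with a designated root such that all arcs are oriented away from the root; it is balanced if all root-to-leaf paths have the same length, and its height is the maximum length of a root-to-leaf path. For $k,d\in\mathbb{N}$, a $(k,d)$-broom rooted at $r$ is an out-arborescence $T$ with root $r$ for which there is an integer $1\le \ell\le k+1$ such that either (i) $\ell\le k$ and $T$ is a balanced out-arborescence of height $\ell$ in which every non-leaf vertex has out-degree exactly $d$; or (ii) $\ell=k+1$ and $T$ is obtained from a balanced out-arborescence of height $k+1$ in which every non-leaf vertex has out-degree exactly $d$ by subdividing each out-arc of $r$ an arbitrary number of times. Internal vertices of a broom are those that are neither the root nor a leaf. A digraph $D$ is a $(k,d)$-broom digraph with (non-empty) root set $R\subseteq V(D)$ if there are subdigraphs $(T_r)_{r\in R}$ of $D$ such that $D=\bigcup_{r\in R}T_r$; each $T_r$ is a $(k,d)$-broom rooted at $r$ all of whose leaves lie in $R$ and all of whose internal vertices lie in $V(D)\setminus R$; and $V(T_{r_1})\cap V(T_{r_2})\subseteq R$ for all distinct $r_1,r_2\in R$. For a $(k,d)$-broom digraph $D$ with root set $R$ and a word $\mathbf{a}=(\mathbf{a}_1,\dots,\mathbf{a}_t)\in\{0,1\}^t$, a vertex $v\in V(D)$ has $t$-type $\mathbf{a}$ if for every $i\in\{1,\dots,t\}$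 and every vertex $u$ reachable from $v$ by a directed walk in $D$ of length exactly $i$, we have $u\in R$ if and only if $\mathbf{a}_i=1$. $D$ is $t$-typed if every vertex of $D$ has some $t$-type $\mathbf{a}\in\{0,1\}^t$ (in particular every broom digraph is $0$-typed). -}

module Defs where

open import Data.Nat using (ℕ; zero; suc; _+_; _*_; _∸_; _^_; _≤_; NonZero)
open import Data.Nat.Properties using (m^n≢0)
open import Data.Nat.DivMod using (_/_)
open import Data.Fin using (Fin; toℕ)
open import Data.Fin.Subset using (Subset; _∈_; _∉_)
open import Data.Bool using (Bool; true)
open import Data.List using (List; []; _∷_; _++_; length)
open import Data.List.Membership.Propositional using () renaming (_∈_ to _∈ₗ_)
open import Data.List.Relation.Unary.All using (All)
open import Data.List.Relation.Unary.Unique.Propositional using (Unique)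
open import Data.Product using (Σ; ∃; ∃-syntax; _×_; _,_)
open import Relation.Binary.PropositionalEquality using (_≡_; _≢_)
open import Function.Bundles using (_⇔_)

ceilDiv : ℕ → (m : ℕ) → .{{NonZero m}} → ℕ
ceilDiv a m = (a + m ∸ 1) / m

reducedDeg : ℕ → ℕ → ℕ
reducedDeg d t = ceilDiv d (2 ^ (t * (t ∸ 1) / 2)) {{m^n≢0 2 (t * (t ∸ 1) / 2)}}

record Digraph (n : ℕ) : Set₁ where
  field
    V : Fin n → Set
    A : Fin n → Fin n → Set
open Digraph public

_⊆D_ : ∀ {n} → Digraph n → Digraph n → Set
D' ⊆D D = (∀ v → V D' v → V D v) × (∀ u w → A D' u w → A D u w)

-- Out-arborescences embedded in Fin n: vertex-labelled rose trees.
-- (Arcs go from a node to each of its children; labels will be required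
-- to be pairwise distinct, so such a tree is exactly an out-arborescence
-- subdigraph.)

data Tree (n : ℕ) : Set where
  node : Fin n → List (Tree n) → Tree n

module _ {n : ℕ} where

  root : Tree n → Fin n
  root (node v _) = v

  mutual
    labels : Tree n → List (Fin n)
    labels (node v ts) = v ∷ labelsL ts

    labelsL : List (Tree n) → List (Fin n)
    labelsL []       = []
    labelsL (t ∷ ts) = labels t ++ labelsL ts

  data ArcIn : Fin n → Fin n → Tree n → Set where
    here  : ∀ {v t ts} → t ∈ₗ ts → ArcIn v (root t) (node v ts)
    there : ∀ {u w v t ts} → t ∈ₗ ts → ArcIn u w t → ArcIn u w (node v ts)

  data IsLeaf : Fin n → Tree n → Set where
    here  : ∀ {v} → IsLeaf v (node v [])
    there : ∀ {u v t ts} → t ∈ₗ ts → IsLeaf u t → IsLeaf u (node v ts)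

  data NonLeaf : Fin n → Tree n → Set where
    here  : ∀ {v t ts} → t ∈ₗ ts → NonLeaf v (node v ts)
    there : ∀ {u v t ts} → t ∈ₗ ts → NonLeaf u t → NonLeaf u (node v ts)

  -- u is an internal vertex: neither the root nor a leaf
  Internal : Fin n → Tree n → Set
  Internal u (node v ts) = ∃[ t ] (t ∈ₗ ts × NonLeaf u t)

  data Full (d : ℕ) : ℕ → Tree n → Set where
    leaf : ∀ {v} → Full d 0 (node v [])
    step : ∀ {ℓ v ts} → 1 ≤ d → length ts ≡ d → All (Full d ℓ) ts →
           Full d (suc ℓ) (node v ts)

  -- a Full d k tree whose incoming arc has been subdivided some number
  -- of times (i.e. preceded by a directed path)
  data Subdiv (d k : ℕ) : Tree n → Set where
    base : ∀ {t} → Full d k t → Subdiv d k t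
    sub  : ∀ {v t} → Subdiv d k t → Subdiv d k (node v (t ∷ []))

  data Broom (k d : ℕ) : Tree n → Set where
    balanced : ∀ {ℓ t} → 1 ≤ ℓ → ℓ ≤ k → Full d ℓ t → Broom k d t
    subdivided : ∀ {v ts} → 1 ≤ d → length ts ≡ d → All (Subdiv d k) ts →
                 Broom k d (node v ts)

record BroomDigraph {n : ℕ} (k d : ℕ) (D : Digraph n) (R : Subset n) : Set where
  field
    nonempty   : ∃[ r ] (r ∈ R)
    T          : Fin n → Tree n
    rooted     : ∀ r → r ∈ R → root (T r) ≡ r
    distinct   : ∀ r → r ∈ R → Unique (labels (T r))
    isBroom    : ∀ r → r ∈ R → Broom k d (T r)
    leavesInR  : ∀ r → r ∈ R → ∀ u → IsLeaf u (T r) → u ∈ R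
    internalNotInR : ∀ r → r ∈ R → ∀ u → Internal u (T r) → u ∉ R
    vertices   : ∀ v → V D v ⇔ (∃[ r ] (r ∈ R × v ∈ₗ labels (T r)))
    arcs       : ∀ u w → A D u w ⇔ (∃[ r ] (r ∈ R × ArcIn u w (T r)))
    disjoint   : ∀ r₁ r₂ → r₁ ∈ R → r₂ ∈ R → r₁ ≢ r₂ →
                 ∀ v → v ∈ₗ labels (T r₁) → v ∈ₗ labels (T r₂) → v ∈ R

data Walk {n : ℕ} (D : Digraph n) : Fin n → Fin n → ℕ → Set where
  nil  : ∀ {v} → Walk D v v 0
  cons : ∀ {u w x ℓ} → A D u w → Walk D w x ℓ → Walk D u x (suc ℓ)

-- v has t-type a  (a i is the letter a_{i+1}, for i : Fin t)
HasType : ∀ {n} (D : Digraph n) (R : Subset n) (t : ℕ) → Fin n → (Fin t → Bool) → Set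
HasType D R t v a = ∀ (i : Fin t) u → Walk D v u (suc (toℕ i)) → (u ∈ R ⇔ (a i ≡ true))

Typed : ∀ {n} (t : ℕ) (D : Digraph n) (R : Subset n) → Set
Typed t D R = ∀ v → V D v → ∃[ a ] HasType D R t v a

-- Given an s-typed (k,d)-broom digraph, prune every broom so that at each
-- node the kept children all have the same s-type: by pigeonhole over the 2^s words, some
-- s-type is shared by at least d/2^s of the d children, so e children can be kept as soon as
-- (e - 1) 2^s < d. Pruning only deletes subtrees, so the result is a (k,e)-broom subdigraph
-- and vertex types survive. Since s < k, the children of a node are either all leaves, hence
-- in R, or all internal, hence outside R; and since brooms meet only in R, all out-arcs of a
-- vertex go to the children of a single tree node. So the (s+1)-type of a vertex is read off
-- any of its children: whether the child lies in R, followed by the child's s-type. Running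
-- s = 0, ..., t - 1 divides the degree by 2^(0 + 1 + ... + (t - 1)) = 2^(t(t - 1)/2).

module Submission where

open import Defs
open import Data.Bool using (Bool; true; false) renaming (_≟_ to _≟ᵇ_)
open import Data.Empty using (⊥; ⊥-elim)
open import Data.Fin using (Fin; zero; suc; toℕ) renaming (_≟_ to _≟ᶠ_)
open import Data.Fin.Properties using (any?)
open import Data.Fin.Subset using (Subset) renaming (_∈_ to _∈ˢ_; _∉_ to _∉ˢ_)
open import Data.Fin.Subset.Properties using () renaming (_∈?_ to _∈ˢ?_)
open import Data.List using (List; []; _∷_; _++_; [_]; length; map; filter; take)
open import Data.List.Properties using (length-take)
open import Data.List.Membership.Propositional using (_∈_)
open import Data.List.Membership.Propositional.Properties using (∈-map⁺; ∈-map⁻)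
import Data.List.Membership.DecPropositional as DecMembership
open import Data.List.Relation.Unary.All as All using (All; []; _∷_)
open import Data.List.Relation.Unary.All.Properties using (all-filter; ++⁻ʳ)
open import Data.List.Relation.Unary.AllPairs using ([]; _∷_)
open import Data.List.Relation.Unary.Any using (here; there)
open import Data.List.Relation.Unary.Any.Properties using (++⁻)
open import Data.List.Relation.Unary.Unique.Propositional using (Unique)
open import Data.List.Relation.Unary.Unique.Propositional.Properties using (Unique[x∷xs]⇒x∉xs)
open import Data.List.Relation.Binary.Pointwise using (Pointwise; []; _∷_; Pointwise-length)
open import Data.List.Relation.Binary.Sublist.Heterogeneous using (Sublist; []; _∷_; _∷ʳ_)
open import Data.List.Relation.Binary.Sublist.Heterogeneous.Properties
  using (fromPointwise) renaming (trans to Sublist-trans)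
open import Data.List.Relation.Binary.Sublist.Propositional using (_⊆_; ⊆-refl; ⊆-trans)
open import Data.List.Relation.Binary.Sublist.Propositional.Properties
  using (All-resp-⊆; Any-resp-⊆; ++⁺; ++⁺ˡ; ++⁺ʳ; take-⊆; filter-⊆)
open import Data.Nat using (ℕ; zero; suc; _+_; _*_; _∸_; _^_; _≤_; _<_; _≡ᵇ_; z≤n; s≤s; NonZero)
open import Data.Nat.Properties
open import Data.Nat.DivMod using (_/_; m/n*n≤m; m≥n⇒m/n>0; +-distrib-/-∣ʳ; m*n/n≡m)
open import Data.Nat.Divisibility using (divides-refl)
open import Data.Nat.Tactic.RingSolver using (solve-∀)
open import Data.Product using (Σ; ∃-syntax; _×_; _,_; proj₁; proj₂; map₁; map₂)
open import Data.Sum using (_⊎_; inj₁; inj₂)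
open import Data.Vec using (Vec; []; _∷_; head; tail; lookup; tabulate)
open import Data.Vec.Properties using ([]=⇒lookup; lookup⇒[]=; lookup∘tabulate)
open import Data.Vec.Functional using () renaming (_∷_ to _◂_)
open import Function using (_∘_; _∘′_; const; id)
open import Function.Bundles using (_⇔_; mk⇔; Equivalence)
open import Relation.Binary.PropositionalEquality
  using (_≡_; _≗_; refl; sym; trans; cong; cong₂; subst; module ≡-Reasoning)
open import Relation.Nullary using (Dec; yes; no; contradiction)
open import Relation.Nullary.Decidable using (map′; _×-dec_)

open Equivalence using (to; from)

m≤n⇒m+n≤2*n : ∀ {a b} → a ≤ b → a + b ≤ 2 * b
m≤n⇒m+n≤2*n {a} {b} a≤b = ≤-trans (+-monoˡ-≤ b a≤b) (≤-reflexive (cong (b +_) (sym (+-identityʳ b))))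

pred-*-bound : ∀ {e m d x} → 1 ≤ e → (e ∸ 1) * m < d → d ≤ m * x → e ≤ x
pred-*-bound {suc e} {m} {d} {x} _ lt le =
  *-cancelʳ-< m e x (<-≤-trans lt (≤-trans le (≤-reflexive (*-comm m x))))

triangular : ℕ → ℕ
triangular zero    = 0
triangular (suc t) = triangular t + t

triangular≡ : ∀ t → triangular t ≡ t * (t ∸ 1) / 2
triangular≡ zero    = refl
triangular≡ (suc t) = begin
  triangular t + t            ≡⟨ cong₂ _+_ (triangular≡ t) (sym (m*n/n≡m t 2)) ⟩
  t * (t ∸ 1) / 2 + t * 2 / 2 ≡⟨ sym (+-distrib-/-∣ʳ (t * (t ∸ 1)) (divides-refl t)) ⟩
  (t * (t ∸ 1) + t * 2) / 2   ≡⟨ cong (_/ 2) (sym (double t)) ⟩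
  suc t * t / 2               ∎
  where
  open ≡-Reasoning
  double : ∀ t → suc t * t ≡ t * (t ∸ 1) + t * 2
  double zero    = refl
  double (suc t) = ring t
    where
    ring : ∀ t → suc (suc t) * suc t ≡ suc t * t + suc t * 2
    ring = solve-∀

ceilDiv-positive : ∀ a m .{{_ : NonZero m}} → 1 ≤ a → 1 ≤ ceilDiv a m
ceilDiv-positive (suc a) m _ = m≥n⇒m/n>0 (m≤n+m m a)

ceilDiv-pred-bound : ∀ a m .{{_ : NonZero m}} → 1 ≤ a → (ceilDiv a m ∸ 1) * m < a
ceilDiv-pred-bound (suc a) m _ = s≤s (begin
  (q ∸ 1) * m   ≡⟨ *-distribʳ-∸ m q 1 ⟩
  q * m ∸ 1 * m ≡⟨ cong (q * m ∸_) (*-identityˡ m) ⟩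
  q * m ∸ m     ≤⟨ ∸-monoˡ-≤ m (m/n*n≤m (a + m) m) ⟩
  a + m ∸ m     ≡⟨ m+n∸n≡m a m ⟩
  a             ∎)
  where
  open ≤-Reasoning
  q = ceilDiv (suc a) m

Unique-resp-⊆ : ∀ {a} {A : Set a} {xs ys : List A} → xs ⊆ ys → Unique ys → Unique xs
Unique-resp-⊆ []           []       = []
Unique-resp-⊆ (_ ∷ʳ xs⊆)   (_ ∷ u)  = Unique-resp-⊆ xs⊆ u
Unique-resp-⊆ (refl ∷ xs⊆) (x∉ ∷ u) = All-resp-⊆ xs⊆ x∉ ∷ Unique-resp-⊆ xs⊆ u

Unique-++⇒disjoint : ∀ {a} {A : Set a} (xs : List A) {ys : List A} {x : A} →
                     Unique (xs ++ ys) → x ∈ xs → x ∈ ys → ⊥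
Unique-++⇒disjoint (_ ∷ xs) (x∉ ∷ _) (here refl)  x∈ys = All.lookup (++⁻ʳ xs x∉) x∈ys refl
Unique-++⇒disjoint (_ ∷ xs) (_ ∷ u)  (there x∈xs) x∈ys = Unique-++⇒disjoint xs u x∈xs x∈ys

Vec-0-η : ∀ {a} {A : Set a} (v : Vec A 0) → v ≡ []
Vec-0-η [] = refl

Vec-η : ∀ {a} {A : Set a} {m} (v : Vec A (suc m)) → v ≡ head v ∷ tail v
Vec-η (_ ∷ _) = refl

tabulate-injective : ∀ {a} {A : Set a} {m} {f g : Fin m → A} → tabulate f ≡ tabulate g → f ≗ g
tabulate-injective {f = f} {g} eq i =
  trans (sym (lookup∘tabulate f i)) (trans (cong (λ v → lookup v i) eq) (lookup∘tabulate g i))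

module _ {a} {A : Set a} where

  length-filter-≟ᵇ : (g : A → Bool) (xs : List A) →
    length (filter ((_≟ᵇ true) ∘ g) xs) + length (filter ((_≟ᵇ false) ∘ g) xs) ≡ length xs
  length-filter-≟ᵇ g []       = refl
  length-filter-≟ᵇ g (x ∷ xs) with g x
  ... | true  = cong suc (length-filter-≟ᵇ g xs)
  ... | false = trans (+-suc _ _) (cong suc (length-filter-≟ᵇ g xs))

  bool-pigeonhole : (g : A → Bool) (xs : List A) →
                    ∃[ b ] (length xs ≤ 2 * length (filter ((_≟ᵇ b) ∘ g) xs))
  bool-pigeonhole g xs = larger (≤-total (count true) (count false))
    where
    count : Bool → ℕ
    count b = length (filter ((_≟ᵇ b) ∘ g) xs)

    larger : count true ≤ count false ⊎ count false ≤ count true → ∃[ b ] (length xs ≤ 2 * count b)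
    larger (inj₁ t≤f) = false , ≤-trans (≤-reflexive (sym (length-filter-≟ᵇ g xs))) (m≤n⇒m+n≤2*n t≤f)
    larger (inj₂ f≤t) =
      true , ≤-trans (≤-reflexive (trans (sym (length-filter-≟ᵇ g xs)) (+-comm (count true) _))) (m≤n⇒m+n≤2*n f≤t)

  -- Halve the list s times, keeping the more frequent value of one coordinate each time.
  pigeonhole : ∀ s (f : A → Vec Bool s) (xs : List A) →
               ∃[ c ] ∃[ ys ] (ys ⊆ xs × All (λ y → f y ≡ c) ys × length xs ≤ 2 ^ s * length ys)
  pigeonhole zero    f xs = [] , xs , ⊆-refl , All.universal (λ y → Vec-0-η (f y)) xs ,
                            ≤-reflexive (sym (*-identityˡ _))
  pigeonhole (suc s) f xs
    with b , half ← bool-pigeonhole (head ∘ f) xs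
    with c , ys , ys⊆ , agree , bound ← pigeonhole s (tail ∘ f) (filter ((_≟ᵇ b) ∘ head ∘ f) xs)
    = b ∷ c , ys , ⊆-trans ys⊆ (filter-⊆ _ xs) ,
      All.zipWith (λ (h , t) → trans (Vec-η _) (cong₂ _∷_ h t))
                  (All-resp-⊆ ys⊆ (all-filter ((_≟ᵇ b) ∘ head ∘ f) xs) , agree) ,
      ≤-trans half (≤-trans (*-monoʳ-≤ 2 bound) (≤-reflexive (sym (*-assoc 2 (2 ^ s) (length ys)))))

-- Trees

module _ {n : ℕ} where

  private variable
    u v w x : Fin n
    c c′ t t′ : Tree n
    cs cs′ ts us : List (Tree n)

  childless : Tree n → Bool
  childless (node _ [])      = true
  childless (node _ (_ ∷ _)) = false

  root∈labels : (t : Tree n) → root t ∈ labels t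
  root∈labels (node _ _) = here refl

  labels⊆labelsL : c ∈ ts → labels c ⊆ labelsL ts
  labels⊆labelsL {ts = _ ∷ _}  (here refl) = ++⁺ʳ _ ⊆-refl
  labels⊆labelsL {ts = c ∷ _} (there c∈)  = ++⁺ˡ (labels c) (labels⊆labelsL c∈)

  ArcIn⇒source∈ : ArcIn u w t → u ∈ labels t
  ArcIn⇒source∈ (here _)      = here refl
  ArcIn⇒source∈ (there c∈ a) = there (Any-resp-⊆ (labels⊆labelsL c∈) (ArcIn⇒source∈ a))

  ArcIn⇒target∈ : ArcIn u w t → w ∈ labels t
  ArcIn⇒target∈ (here {t = c} c∈) = there (Any-resp-⊆ (labels⊆labelsL c∈) (root∈labels c))
  ArcIn⇒target∈ (there c∈ a)     = there (Any-resp-⊆ (labels⊆labelsL c∈) (ArcIn⇒target∈ a))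

  ArcIn⇒NonLeaf : ArcIn u w t → NonLeaf u t
  ArcIn⇒NonLeaf (here c∈)    = here c∈
  ArcIn⇒NonLeaf (there c∈ a) = there c∈ (ArcIn⇒NonLeaf a)

  ArcIn⇒root⊎Internal : ArcIn u w t → u ≡ root t ⊎ Internal u t
  ArcIn⇒root⊎Internal (here _)     = inj₁ refl
  ArcIn⇒root⊎Internal (there c∈ a) = inj₂ (_ , c∈ , ArcIn⇒NonLeaf a)

  children-disjoint : Unique (labelsL ts) → c ∈ ts → c′ ∈ ts → x ∈ labels c → x ∈ labels c′ → c ≡ c′
  children-disjoint                _ (here refl) (here refl) _ _ = refl
  children-disjoint {ts = c ∷ _}   u (here refl) (there c′∈) x∈c x∈c′ =
    ⊥-elim (Unique-++⇒disjoint (labels c) u x∈c (Any-resp-⊆ (labels⊆labelsL c′∈) x∈c′))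
  children-disjoint {ts = c′ ∷ _}  u (there c∈) (here refl) x∈c x∈c′ =
    ⊥-elim (Unique-++⇒disjoint (labels c′) u x∈c′ (Any-resp-⊆ (labels⊆labelsL c∈) x∈c))
  children-disjoint {ts = c″ ∷ _}  u (there c∈) (there c′∈) x∈c x∈c′ =
    children-disjoint (Unique-resp-⊆ (++⁺ˡ (labels c″) ⊆-refl) u) c∈ c′∈ x∈c x∈c′

  infix 4 _⊑_
  data _⊑_ (s : Tree n) : Tree n → Set where
    here  : s ⊑ s
    there : ∀ {v c ts} → c ∈ ts → s ⊑ c → s ⊑ node v ts

  ⊑⇒root∈labels : t′ ⊑ t → root t′ ∈ labels t
  ⊑⇒root∈labels {t = t} here = root∈labels t
  ⊑⇒root∈labels (there c∈ o)  = there (Any-resp-⊆ (labels⊆labelsL c∈) (⊑⇒root∈labels o))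

  ⊑-child⇒root∈labelsL : c ∈ ts → t′ ⊑ c → root t′ ∈ labelsL ts
  ⊑-child⇒root∈labelsL c∈ o = Any-resp-⊆ (labels⊆labelsL c∈) (⊑⇒root∈labels o)

  child⊑ : node v cs ⊑ t → c ∈ cs → c ⊑ t
  child⊑ here         c∈ = there c∈ here
  child⊑ (there c′∈ o) c∈ = there c′∈ (child⊑ o c∈)

  mutual
    ∈labels⇒⊑ : (t : Tree n) → x ∈ labels t → ∃[ cs ] (node x cs ⊑ t)
    ∈labels⇒⊑ (node _ ts) (here refl) = ts , here
    ∈labels⇒⊑ (node _ ts) (there x∈) with c , c∈ , cs , o ← ∈labelsL⇒⊑ ts x∈ = cs , there c∈ o

    ∈labelsL⇒⊑ : (ts : List (Tree n)) → x ∈ labelsL ts → ∃[ c ] (c ∈ ts × ∃[ cs ] (node x cs ⊑ c))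
    ∈labelsL⇒⊑ (c ∷ ts) x∈ with ++⁻ (labels c) x∈
    ... | inj₁ x∈c  = c , here refl , ∈labels⇒⊑ c x∈c
    ... | inj₂ x∈ts with c′ , c′∈ , occ ← ∈labelsL⇒⊑ ts x∈ts = c′ , there c′∈ , occ

  ArcIn⇒⊑ : ArcIn u w t → ∃[ cs ] (node u cs ⊑ t × w ∈ map root cs)
  ArcIn⇒⊑ (here c∈) = _ , here , ∈-map⁺ root c∈
  ArcIn⇒⊑ (there c∈ a) with cs , o , w∈ ← ArcIn⇒⊑ a = cs , there c∈ o , w∈

  ⊑-unique : Unique (labels t) → node x cs ⊑ t → node x cs′ ⊑ t → cs ≡ cs′
  ⊑-unique _ here here = refl
  ⊑-unique u here (there c∈ o) = ⊥-elim (Unique[x∷xs]⇒x∉xs u (⊑-child⇒root∈labelsL c∈ o))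
  ⊑-unique u (there c∈ o) here = ⊥-elim (Unique[x∷xs]⇒x∉xs u (⊑-child⇒root∈labelsL c∈ o))
  ⊑-unique (_ ∷ u) (there c∈ o) (there c′∈ o′)
    with refl ← children-disjoint u c∈ c′∈ (⊑⇒root∈labels o) (⊑⇒root∈labels o′)
    = ⊑-unique (Unique-resp-⊆ (labels⊆labelsL c∈) u) o o′

  ⊑-NonLeaf : t′ ⊑ t → NonLeaf u t′ → NonLeaf u t
  ⊑-NonLeaf here nl = nl
  ⊑-NonLeaf (there c∈ o) nl = there c∈ (⊑-NonLeaf o nl)

  ⊑-IsLeaf : t′ ⊑ t → IsLeaf u t′ → IsLeaf u t
  ⊑-IsLeaf here l = l
  ⊑-IsLeaf (there c∈ o) l = there c∈ (⊑-IsLeaf o l)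

  child-Internal : node v cs ⊑ t → c ∈ cs → NonLeaf u c → Internal u t
  child-Internal here          c∈ nl = _ , c∈ , nl
  child-Internal (there c′∈ o) c∈ nl = _ , c′∈ , ⊑-NonLeaf (child⊑ o c∈) nl

  Agree : {B : Set} → (Tree n → B) → List (Tree n) → Set
  Agree f cs = ∀ {c c′} → c ∈ cs → c′ ∈ cs → f c ≡ f c′

  SiblingsAgree : {B : Set} → (Tree n → B) → Tree n → Set
  SiblingsAgree f t = ∀ {v cs} → node v cs ⊑ t → Agree f cs

  siblingsAgree-node : ∀ {B : Set} {f : Tree n → B} →
                       Agree f ts → All (SiblingsAgree f) ts → SiblingsAgree f (node v ts)
  siblingsAgree-node agree agrees here         = agree
  siblingsAgree-node agree agrees (there c∈ o) = All.lookup agrees c∈ o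

  Agree-singleton : ∀ {B : Set} {f : Tree n → B} → Agree f [ c ]
  Agree-singleton (here refl) (here refl) = refl
  Agree-singleton (here refl) (there ())
  Agree-singleton (there ())  _

  All-≡⇒Agree : ∀ {B : Set} {f : Tree n → B} {b} → All (λ c → f c ≡ b) cs → Agree f cs
  All-≡⇒Agree all c∈ c′∈ = trans (All.lookup all c∈) (sym (All.lookup all c′∈))

  Full-childless : ∀ {d ℓ} → Full d ℓ t → childless t ≡ (ℓ ≡ᵇ 0)
  Full-childless leaf                      = refl
  Full-childless (step {ts = _ ∷ _} _ _ _) = refl
  Full-childless (step {ts = []} () refl _)

  Subdiv-childless : ∀ {d k} → 1 ≤ k → Subdiv d k t → childless t ≡ false
  Subdiv-childless (s≤s _) (base f) = Full-childless f
  Subdiv-childless _       (sub _)  = refl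

  mutual
    Full-siblingsAgree : ∀ {d ℓ} → Full d ℓ t → SiblingsAgree childless t
    Full-siblingsAgree leaf          = siblingsAgree-node (λ ()) []
    Full-siblingsAgree (step _ _ fs) =
      siblingsAgree-node (All-≡⇒Agree (All.map Full-childless fs)) (Full*-siblingsAgree fs)

    Full*-siblingsAgree : ∀ {d ℓ} → All (Full d ℓ) ts → All (SiblingsAgree childless) ts
    Full*-siblingsAgree []       = []
    Full*-siblingsAgree (f ∷ fs) = Full-siblingsAgree f ∷ Full*-siblingsAgree fs

  Subdiv-siblingsAgree : ∀ {d k} → Subdiv d k t → SiblingsAgree childless t
  Subdiv-siblingsAgree (base f) = Full-siblingsAgree f
  Subdiv-siblingsAgree (sub s)  =
    siblingsAgree-node Agree-singleton (Subdiv-siblingsAgree s ∷ [])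

  Broom-siblingsAgree : ∀ {k d} → 1 ≤ k → Broom k d t → SiblingsAgree childless t
  Broom-siblingsAgree _   (balanced _ _ f)     = Full-siblingsAgree f
  Broom-siblingsAgree 1≤k (subdivided _ _ ss) =
    siblingsAgree-node (All-≡⇒Agree (All.map (Subdiv-childless 1≤k) ss))
                       (All.map Subdiv-siblingsAgree ss)

  Broom⇒1≤degree : ∀ {k d} → Broom k d t → 1 ≤ d
  Broom⇒1≤degree (balanced (s≤s _) _ (step 1≤d _ _)) = 1≤d
  Broom⇒1≤degree (subdivided 1≤d _ _)               = 1≤d

  -- u ≼ t: u is obtained from t by deleting subtrees, but never all children of a node.
  infix 4 _≼_
  data _≼_ : Tree n → Tree n → Set where
    node : ∀ {v us ts} → Sublist _≼_ us ts → (us ≡ [] → ts ≡ []) → node v us ≼ node v ts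

  mutual
    ≼-labels : t′ ≼ t → labels t′ ⊆ labels t
    ≼-labels (node us≼ _) = refl ∷ ≼*-labelsL us≼

    ≼*-labelsL : Sublist _≼_ us ts → labelsL us ⊆ labelsL ts
    ≼*-labelsL []           = []
    ≼*-labelsL (t ∷ʳ us≼)   = ++⁺ˡ (labels t) (≼*-labelsL us≼)
    ≼*-labelsL (u≼ ∷ us≼)   = ++⁺ (≼-labels u≼) (≼*-labelsL us≼)

  ≼-root : t′ ≼ t → root t′ ≡ root t
  ≼-root (node _ _) = refl

  ≼*-∈ : Sublist _≼_ us ts → c ∈ us → ∃[ t ] (t ∈ ts × c ≼ t)
  ≼*-∈ (_ ∷ʳ us≼) c∈ with t , t∈ , c≼ ← ≼*-∈ us≼ c∈ = t , there t∈ , c≼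
  ≼*-∈ (c≼ ∷ _)  (here refl) = _ , here refl , c≼
  ≼*-∈ (_ ∷ us≼) (there c∈) with t , t∈ , c≼ ← ≼*-∈ us≼ c∈ = t , there t∈ , c≼

  ≼-ArcIn : t′ ≼ t → ArcIn u w t′ → ArcIn u w t
  ≼-ArcIn (node us≼ _) (here c∈) with _ , t∈ , node _ _ ← ≼*-∈ us≼ c∈ = here t∈
  ≼-ArcIn (node us≼ _) (there c∈ a) with _ , t∈ , c≼ ← ≼*-∈ us≼ c∈ = there t∈ (≼-ArcIn c≼ a)

  ≼-IsLeaf : t′ ≼ t → IsLeaf u t′ → IsLeaf u t
  ≼-IsLeaf (node _ nonempty) here with refl ← nonempty refl = here
  ≼-IsLeaf (node us≼ _) (there c∈ l) with _ , t∈ , c≼ ← ≼*-∈ us≼ c∈ = there t∈ (≼-IsLeaf c≼ l)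

  ≼-NonLeaf : t′ ≼ t → NonLeaf u t′ → NonLeaf u t
  ≼-NonLeaf (node us≼ _) (here c∈) with _ , t∈ , _ ← ≼*-∈ us≼ c∈ = here t∈
  ≼-NonLeaf (node us≼ _) (there c∈ nl) with _ , t∈ , c≼ ← ≼*-∈ us≼ c∈ = there t∈ (≼-NonLeaf c≼ nl)

  ≼-Internal : t′ ≼ t → Internal u t′ → Internal u t
  ≼-Internal (node us≼ _) (c , c∈ , nl) with t , t∈ , c≼ ← ≼*-∈ us≼ c∈ = t , t∈ , ≼-NonLeaf c≼ nl

-- Pruning brooms

module BroomPruning {n s : ℕ} (κ : Fin n → Vec Bool s) {d e : ℕ} (1≤e : 1 ≤ e)
                    (deg : (e ∸ 1) * 2 ^ s < d) where

  Pruned : (Tree n → Set) → Tree n → Set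
  Pruned P t = ∃[ u ] (P u × u ≼ t × SiblingsAgree (κ ∘′ root) u)

  PrunedList : (Tree n → Set) → List (Tree n) → Set
  PrunedList P ts = ∃[ us ] (All P us × Pointwise _≼_ us ts × All (SiblingsAgree (κ ∘′ root)) us)

  []ᴾ : ∀ {P} → PrunedList P []
  []ᴾ = [] , [] , [] , []

  _∷ᴾ_ : ∀ {P t ts} → Pruned P t → PrunedList P ts → PrunedList P (t ∷ ts)
  (u , p , u≼ , agree) ∷ᴾ (us , ps , pw , agrees) = u ∷ us , p ∷ ps , u≼ ∷ pw , agree ∷ agrees

  choose : ∀ us → length us ≡ d → ∃[ us′ ] (us′ ⊆ us × length us′ ≡ e × Agree (κ ∘′ root) us′)
  choose us refl with c , ys , ys⊆ , agree , bound ← pigeonhole s (κ ∘′ root) us =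
    take e ys , ⊆-trans (take-⊆ e ys) ys⊆ ,
    trans (length-take e ys) (m≤n⇒m⊓n≡m (pred-*-bound 1≤e deg bound)) ,
    All-≡⇒Agree (All-resp-⊆ (take-⊆ e ys) agree)

  never-childless : ∀ {us ts : List (Tree n)} → length us ≡ e → us ≡ [] → ts ≡ []
  never-childless len refl = contradiction (subst (1 ≤_) (sym len) 1≤e) λ ()

  prunedNode : ∀ {P v ts} → PrunedList P ts → length ts ≡ d →
               ∃[ us ] (All P us × length us ≡ e × node v us ≼ node v ts ×
                        SiblingsAgree (κ ∘′ root) (node v us))
  prunedNode (us , ps , pw , agrees) len
    with us′ , us′⊆ , len′ , agree ← choose us (trans (Pointwise-length pw) len) =
    us′ , All-resp-⊆ us′⊆ ps , len′ ,
    node (Sublist-trans (λ { refl u≼ → u≼ }) us′⊆ (fromPointwise pw)) (never-childless len′) ,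
    siblingsAgree-node agree (All-resp-⊆ us′⊆ agrees)

  pruneEach : ∀ {P Q : Tree n → Set} {ts} → (∀ {t} → Q t → Pruned P t) → All Q ts → PrunedList P ts
  pruneEach prune []       = []ᴾ
  pruneEach prune (q ∷ qs) = prune q ∷ᴾ pruneEach prune qs

  mutual
    pruneFull : ∀ {ℓ t} → Full d ℓ t → Pruned (Full e ℓ) t
    pruneFull (leaf {v}) = node v [] , leaf , node [] (λ _ → refl) , siblingsAgree-node (λ ()) []
    pruneFull (step {v = v} _ len fs) =
      let us , ps , len′ , u≼ , agree = prunedNode {v = v} (pruneFull* fs) len
      in node v us , step 1≤e len′ ps , u≼ , agree

    pruneFull* : ∀ {ℓ ts} → All (Full d ℓ) ts → PrunedList (Full e ℓ) ts
    pruneFull* []       = []ᴾ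
    pruneFull* (f ∷ fs) = pruneFull f ∷ᴾ pruneFull* fs

  pruneSubdiv : ∀ {k t} → Subdiv d k t → Pruned (Subdiv e k) t
  pruneSubdiv (base f) = map₂ (map₁ base) (pruneFull f)
  pruneSubdiv (sub {v} s) with u , p , u≼ , agree ← pruneSubdiv s =
    node v [ u ] , sub p , node (u≼ ∷ []) (λ ()) ,
    siblingsAgree-node Agree-singleton (agree ∷ [])

  pruneBroom : ∀ {k t} → Broom k d t → Pruned (Broom k e) t
  pruneBroom (balanced 1≤ℓ ℓ≤k f) = map₂ (map₁ (balanced 1≤ℓ ℓ≤k)) (pruneFull f)
  pruneBroom (subdivided {v = v} _ len ss) =
    let us , ps , len′ , u≼ , agree = prunedNode {v = v} (pruneEach pruneSubdiv ss) len
    in node v us , subdivided 1≤e len′ ps , u≼ , agree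

⊆D-trans : ∀ {n} {D₁ D₂ D₃ : Digraph n} → D₁ ⊆D D₂ → D₂ ⊆D D₃ → D₁ ⊆D D₃
⊆D-trans (V₁⊆ , A₁⊆) (V₂⊆ , A₂⊆) = (λ v → V₂⊆ v ∘ V₁⊆ v) , (λ u w → A₂⊆ u w ∘ A₁⊆ u w)

Walk-⊆D : ∀ {n} {D′ D : Digraph n} {u w ℓ} → D′ ⊆D D → Walk D′ u w ℓ → Walk D u w ℓ
Walk-⊆D D′⊆D nil           = nil
Walk-⊆D D′⊆D (cons a walk) = cons (proj₂ D′⊆D _ _ a) (Walk-⊆D D′⊆D walk)

HasType-⊆D : ∀ {n} {D′ D : Digraph n} {R s v a} → D′ ⊆D D → HasType D R s v a → HasType D′ R s v a
HasType-⊆D D′⊆D type i u walk = type i u (Walk-⊆D D′⊆D walk)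

∉ˢ⇒lookup≡false : ∀ {n} {p : Subset n} {x} → x ∉ˢ p → lookup p x ≡ false
∉ˢ⇒lookup≡false {p = p} {x} x∉ with lookup p x in eq
... | true  = ⊥-elim (x∉ (lookup⇒[]= x p eq))
... | false = refl

treeUnion : ∀ {n} → Subset n → (Fin n → Tree n) → Digraph n
treeUnion R T = record
  { V = λ v → ∃[ r ] (r ∈ˢ R × v ∈ labels (T r))
  ; A = λ u w → ∃[ r ] (r ∈ˢ R × ArcIn u w (T r))
  }

module _ {n k d : ℕ} {D : Digraph n} {R : Subset n} (B : BroomDigraph k d D R) where

  open BroomDigraph B
  open DecMembership (_≟ᶠ_ {n}) using (_∈?_)

  1≤degree : 1 ≤ d
  1≤degree with r , r∈ ← nonempty = Broom⇒1≤degree (isBroom r r∈)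

  V? : ∀ v → Dec (V D v)
  V? v = map′ (from (vertices v)) (to (vertices v)) (any? λ r → (r ∈ˢ? R) ×-dec (v ∈? labels (T r)))

  A⇒V-target : ∀ {v w} → A D v w → V D w
  A⇒V-target {v} {w} a with r , r∈ , arc ← to (arcs v w) a =
    from (vertices w) (r , r∈ , ArcIn⇒target∈ arc)

  -- A vertex of R is internal to no broom; any other vertex lies in only one broom.
  home : ∀ {v} → V D v →
         ∃[ r ] (r ∈ˢ R × v ∈ labels (T r) × ∀ {w r′} → r′ ∈ˢ R → ArcIn v w (T r′) → r′ ≡ r)
  home {v} v∈D with v ∈ˢ? R
  ... | yes v∈R = v , v∈R , subst (_∈ labels (T v)) (rooted v v∈R) (root∈labels (T v)) , from-root
    where
    from-root : ∀ {w r′} → r′ ∈ˢ R → ArcIn v w (T r′) → r′ ≡ v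
    from-root {r′ = r′} r′∈ arc with ArcIn⇒root⊎Internal arc
    ... | inj₁ v≡root = sym (trans v≡root (rooted r′ r′∈))
    ... | inj₂ v-int  = ⊥-elim (internalNotInR r′ r′∈ v v-int v∈R)
  ... | no v∉R with r , r∈ , v∈T ← to (vertices v) v∈D = r , r∈ , v∈T , same-tree
    where
    same-tree : ∀ {w r′} → r′ ∈ˢ R → ArcIn v w (T r′) → r′ ≡ r
    same-tree {r′ = r′} r′∈ arc with r′ ≟ᶠ r
    ... | yes r′≡r = r′≡r
    ... | no r′≢r  = ⊥-elim (v∉R (disjoint r′ r r′∈ r∈ r′≢r v (ArcIn⇒source∈ arc) v∈T))

  out-neighbourhood : ∀ {v} → V D v →
    ∃[ r ] (r ∈ˢ R × ∃[ cs ] (node v cs ⊑ T r × ∀ {w} → A D v w → w ∈ map root cs))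
  out-neighbourhood {v} v∈D with r , r∈ , v∈T , same-tree ← home v∈D with cs , o ← ∈labels⇒⊑ (T r) v∈T =
    r , r∈ , cs , o , child
    where
    child : ∀ {w} → A D v w → w ∈ map root cs
    child {w} a with r′ , r′∈ , arc ← to (arcs v w) a with refl ← same-tree r′∈ arc
      with cs′ , o′ , w∈ ← ArcIn⇒⊑ arc with refl ← ⊑-unique (distinct r r∈) o′ o = w∈

  child-∈R : ∀ {r v cs c} → r ∈ˢ R → node v cs ⊑ T r → c ∈ cs → lookup R (root c) ≡ childless c
  child-∈R {c = node w []}      r∈ o c∈ = []=⇒lookup (leavesInR _ r∈ w (⊑-IsLeaf (child⊑ o c∈) here))
  child-∈R {c = node w (_ ∷ _)} r∈ o c∈ =
    ∉ˢ⇒lookup≡false (internalNotInR _ r∈ w (child-Internal o c∈ (here (here refl))))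

  siblingsAgree-∈R : 1 ≤ k → ∀ r → r ∈ˢ R → SiblingsAgree (lookup R ∘′ root) (T r)
  siblingsAgree-∈R 1≤k r r∈ o c∈ c′∈ =
    trans (child-∈R r∈ o c∈)
          (trans (Broom-siblingsAgree 1≤k (isBroom r r∈) o c∈ c′∈) (sym (child-∈R r∈ o c′∈)))

  type-assignment : ∀ {s} → Typed s D R → ∃[ τ ] (∀ w → V D w → HasType D R s w (τ w))
  type-assignment {s} typed = τ , τ-ok
    where
    τ : Fin n → Fin s → Bool
    τ w with V? w
    ... | yes w∈D = proj₁ (typed w w∈D)
    ... | no _    = const false

    τ-ok : ∀ w → V D w → HasType D R s w (τ w)
    τ-ok w w∈D with V? w
    ... | yes w∈D′ = proj₂ (typed w w∈D′)
    ... | no w∉D   = ⊥-elim (w∉D w∈D)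

  module _ {s} (τ : Fin n → Fin s → Bool) where

    childrenType : List (Tree n) → Fin (suc s) → Bool
    childrenType []      = const false
    childrenType (c ∷ _) = lookup R (root c) ◂ τ (root c)

    childrenType-child : ∀ {cs w} → Agree (lookup R ∘′ root) cs → Agree (tabulate ∘′ τ ∘′ root) cs →
                         w ∈ map root cs → childrenType cs ≗ lookup R w ◂ τ w
    childrenType-child {c ∷ cs} bits keys w∈ i =
      let c′ , c′∈ , w≡ = ∈-map⁻ root w∈
      in subst (λ w → childrenType (c ∷ cs) i ≡ (lookup R w ◂ τ w) i) (sym w≡) (at i c′∈)
      where
      at : ∀ i {c′} → c′ ∈ c ∷ cs → childrenType (c ∷ cs) i ≡ (lookup R (root c′) ◂ τ (root c′)) i
      at zero    c′∈ = bits (here refl) c′∈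
      at (suc i) c′∈ = tabulate-injective (keys (here refl) c′∈) i

    successor-type : ∀ {w} → HasType D R s w (τ w) →
                    ∀ i u → Walk D w u (toℕ i) → u ∈ˢ R ⇔ ((lookup R w ◂ τ w) i ≡ true)
    successor-type type zero    u nil  = mk⇔ []=⇒lookup (lookup⇒[]= u R)
    successor-type type (suc i) u walk = type i u walk

    typed-by-children : (∀ w → V D w → HasType D R s w (τ w)) → 1 ≤ k →
                        (∀ r → r ∈ˢ R → SiblingsAgree (tabulate ∘′ τ ∘′ root) (T r)) → Typed (suc s) D R
    typed-by-children τ-ok 1≤k keys v v∈D =
      let r , r∈ , cs , o , child = out-neighbourhood v∈D in
      childrenType cs , λ i u → λ { (cons a walk) →
        subst (λ b → u ∈ˢ R ⇔ (b ≡ true))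
              (sym (childrenType-child (siblingsAgree-∈R 1≤k r r∈ o) (keys r r∈ o) (child a) i))
              (successor-type (τ-ok _ (A⇒V-target a)) i u walk) }

  module _ {e} (T′ : Fin n → Tree n) (T′-broom : ∀ r → r ∈ˢ R → Broom k e (T′ r))
                (T′≼T : ∀ r → r ∈ˢ R → T′ r ≼ T r) where

    treeUnion-⊆D : treeUnion R T′ ⊆D D
    treeUnion-⊆D = (λ { v (r , r∈ , v∈) → from (vertices v) (r , r∈ , Any-resp-⊆ (≼-labels (T′≼T r r∈)) v∈) })
                 , (λ { u w (r , r∈ , arc) → from (arcs u w) (r , r∈ , ≼-ArcIn (T′≼T r r∈) arc) })

    prunedBroomDigraph : BroomDigraph k e (treeUnion R T′) R
    prunedBroomDigraph = record
      { nonempty       = nonempty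
      ; T              = T′
      ; rooted         = λ r r∈ → trans (≼-root (T′≼T r r∈)) (rooted r r∈)
      ; distinct       = λ r r∈ → Unique-resp-⊆ (≼-labels (T′≼T r r∈)) (distinct r r∈)
      ; isBroom        = T′-broom
      ; leavesInR      = λ r r∈ u leaf → leavesInR r r∈ u (≼-IsLeaf (T′≼T r r∈) leaf)
      ; internalNotInR = λ r r∈ u int → internalNotInR r r∈ u (≼-Internal (T′≼T r r∈) int)
      ; vertices       = λ v → mk⇔ id id
      ; arcs           = λ u w → mk⇔ id id
      ; disjoint       = λ r₁ r₂ r₁∈ r₂∈ r₁≢r₂ v v∈₁ v∈₂ →
          disjoint r₁ r₂ r₁∈ r₂∈ r₁≢r₂ v (Any-resp-⊆ (≼-labels (T′≼T r₁ r₁∈)) v∈₁)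
                                         (Any-resp-⊆ (≼-labels (T′≼T r₂ r₂∈)) v∈₂)
      }

  prune-to-agreement : ∀ {s e} (κ : Fin n → Vec Bool s) → 1 ≤ e → (e ∸ 1) * 2 ^ s < d →
    ∃[ D′ ] (D′ ⊆D D × Σ (BroomDigraph k e D′ R) λ B′ →
             ∀ r → r ∈ˢ R → SiblingsAgree (κ ∘′ root) (BroomDigraph.T B′ r))
  prune-to-agreement {s} {e} κ 1≤e deg =
    treeUnion R T′ , treeUnion-⊆D T′ T′-broom T′≼T , prunedBroomDigraph T′ T′-broom T′≼T ,
    λ r r∈ → proj₂ (proj₂ (pruned r r∈))
    where
    open BroomPruning κ 1≤e deg

    pruneTree : ∀ r → Σ (Tree n) λ u → r ∈ˢ R → Broom k e u × u ≼ T r × SiblingsAgree (κ ∘′ root) u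
    pruneTree r with r ∈ˢ? R
    ... | yes r∈ = let u , broom , u≼ , agree = pruneBroom (isBroom r r∈) in u , λ _ → broom , u≼ , agree
    ... | no r∉  = T r , λ r∈ → ⊥-elim (r∉ r∈)

    T′ : Fin n → Tree n
    T′ r = proj₁ (pruneTree r)

    pruned : ∀ r → r ∈ˢ R → Broom k e (T′ r) × T′ r ≼ T r × SiblingsAgree (κ ∘′ root) (T′ r)
    pruned r = proj₂ (pruneTree r)

    T′-broom : ∀ r → r ∈ˢ R → Broom k e (T′ r)
    T′-broom r r∈ = proj₁ (pruned r r∈)

    T′≼T : ∀ r → r ∈ˢ R → T′ r ≼ T r
    T′≼T r r∈ = proj₁ (proj₂ (pruned r r∈))

-- Typed pruning

module _ {n k : ℕ} where

  typed-step : ∀ {d e s} {D : Digraph n} {R : Subset n} → suc s ≤ k → 1 ≤ e → (e ∸ 1) * 2 ^ s < d →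
               BroomDigraph k d D R → Typed s D R →
               ∃[ D′ ] (D′ ⊆D D × BroomDigraph k e D′ R × Typed (suc s) D′ R)
  typed-step s<k 1≤e deg B typed =
    let τ , τ-ok = type-assignment B typed
        D′ , D′⊆D , B′ , keys = prune-to-agreement B (tabulate ∘′ τ) 1≤e deg
    in D′ , D′⊆D , B′ ,
       typed-by-children B′ τ (λ w w∈ → HasType-⊆D D′⊆D (τ-ok w (proj₁ D′⊆D w w∈)))
                         (≤-trans (s≤s z≤n) s<k) keys

  typed-pruning : ∀ t {d e} {D : Digraph n} {R : Subset n} →
                  t ≤ k → 1 ≤ e → (e ∸ 1) * 2 ^ triangular t < d → BroomDigraph k d D R →
                  ∃[ D′ ] (D′ ⊆D D × BroomDigraph k e D′ R × Typed t D′ R)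
  typed-pruning zero _ 1≤e deg B =
    let D′ , D′⊆D , B′ , _ = prune-to-agreement B {s = 0} (const []) 1≤e deg
    in D′ , D′⊆D , B′ , λ _ _ → (λ ()) , λ ()
  typed-pruning (suc s) {d} {e} s<k 1≤e deg B =
    let D₁ , D₁⊆D , B₁ , typed₁ = typed-pruning s (≤-trans (n≤1+n s) s<k) (s≤s z≤n) deg′ B
        D₂ , D₂⊆D₁ , B₂ , typed₂ = typed-step s<k 1≤e (n<1+n _) B₁ typed₁
    in D₂ , ⊆D-trans D₂⊆D₁ D₁⊆D , B₂ , typed₂
    where
    deg′ : (suc ((e ∸ 1) * 2 ^ s) ∸ 1) * 2 ^ triangular s < d
    deg′ = subst (_< d) (sym (begin
      (e ∸ 1) * 2 ^ s * 2 ^ triangular s   ≡⟨ *-assoc (e ∸ 1) (2 ^ s) (2 ^ triangular s) ⟩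
      (e ∸ 1) * (2 ^ s * 2 ^ triangular s) ≡⟨ cong ((e ∸ 1) *_) (sym (^-distribˡ-+-* 2 s (triangular s))) ⟩
      (e ∸ 1) * 2 ^ (s + triangular s)     ≡⟨ cong (λ x → (e ∸ 1) * 2 ^ x) (+-comm s (triangular s)) ⟩
      (e ∸ 1) * 2 ^ triangular (suc s)     ∎)) deg
      where open ≡-Reasoning

lemma2p10 : ∀ {n : ℕ} (k d t : ℕ) → t ≤ k → (D : Digraph n) (R : Subset n) →
    BroomDigraph k d D R →
    ∃[ D' ] (D' ⊆D D × BroomDigraph k (reducedDeg d t) D' R × Typed t D' R)
lemma2p10 k d t t≤k D R B = typed-pruning t t≤k (ceilDiv-positive d m 1≤d) deg B
  where
  m = 2 ^ (t * (t ∸ 1) / 2)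
  instance _ = m^n≢0 2 (t * (t ∸ 1) / 2)
  1≤d = 1≤degree B

  deg : (reducedDeg d t ∸ 1) * 2 ^ triangular t < d
  deg = subst (λ x → (reducedDeg d t ∸ 1) * 2 ^ x < d) (sym (triangular≡ t)) (ceilDiv-pred-bound d m 1≤d)
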